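{- Let $s\ge 2$ and let $G=K(n_1,\dots,n_s)$ be a complete $s$-partite graph with parts $V_1,\dots,V_s$. Let $j\in\{1,\dots,s\}$. If $n_j\ge 2$, then there is an optimal $1$-relaxed coloring $f$ of $G$ (one using $\chi_1(G)$ colors) with $|f(V_j)|=1$, i.e., all vertices of $V_j$ receive the same color.
   Context: $K(n_1,\dots,n_s)$ denotes the complete $s$-partite graph whose parts $V_1,\dots,V_s$ have $n_1,\dots,n_s$ vertices. A $1$-relaxed $k$-coloring is a map $f:V\to\{1,\dots,k\}$ such that every vertex $u$ has at most one neighbor $v$ with $f(v)=f(u)$; $\chi_1(G)$ is the minimum such $k$. -}

module Defs where

open import Data.Nat using (ℕ; _<_)
open import Data.Fin using (Fin)
open import Data.Product using (Σ; _×_; ∃; proj₁)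
open import Relation.Binary.PropositionalEquality using (_≡_)
open import Relation.Nullary using (¬_)

-- Complete s-partite graph K(n_1,...,n_s): part i has n i vertices.
-- A vertex is a pair (i , a) : part index i and a position a within V_i.
Vertex : {s : ℕ} → (Fin s → ℕ) → Set
Vertex {s} n = Σ (Fin s) (λ i → Fin (n i))

Adj : {s : ℕ} {n : Fin s → ℕ} → Vertex n → Vertex n → Set
Adj u v = ¬ (proj₁ u ≡ proj₁ v)

Is1Relaxed : {s : ℕ} (n : Fin s → ℕ) (k : ℕ) → (Vertex n → Fin k) → Set
Is1Relaxed n k f =
  ∀ u v w → Adj {n = n} u v → Adj {n = n} u w →
  f v ≡ f u → f w ≡ f u → v ≡ w

Has1RelaxedColoring : {s : ℕ} (n : Fin s → ℕ) (k : ℕ) → Set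
Has1RelaxedColoring n k = ∃ (λ (f : Vertex n → Fin k) → Is1Relaxed n k f)

IsChi1 : {s : ℕ} (n : Fin s → ℕ) (k : ℕ) → Set
IsChi1 n k = Has1RelaxedColoring n k × (∀ k′ → k′ < k → ¬ Has1RelaxedColoring n k′)

-- Start from any optimal colouring g and two vertices a₀ ≠ a₁ of V_j, with colours c₁ and c₂.
-- Since a vertex of V_j is adjacent to everything outside V_j, each of c₁, c₂ occurs at most
-- once outside V_j, and if c₁ = c₂ it does not occur there at all. Colour all of V_j with c₁
-- and, outside V_j, recolour c₁ as c₂. Then c₁ no longer occurs outside V_j, so V_j is fine,
-- and the merged class c₂ outside V_j has at most two vertices, hence maximum degree at most 1.
-- The recolouring uses the same colours, so it is again optimal.
module Submission where

open import Defs
open import Level using (Level)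
open import Data.Nat using (ℕ; _≤_; suc; s≤s)
open import Data.Fin using (Fin; _≟_) renaming (zero to fzero; suc to fsuc)
open import Data.Product using (Σ; _×_; _,_; proj₁)
open import Data.Sum as Sum using (_⊎_; inj₁; inj₂)
open import Data.Empty using (⊥-elim)
open import Relation.Nullary using (¬_; Dec; yes; no)
open import Relation.Unary using (Pred; _∪_)
open import Relation.Binary.Definitions using (DecidableEquality)
open import Relation.Binary.PropositionalEquality using (_≡_; _≢_; refl; sym; trans; subst; ≢-sym)

private
  variable
    a ℓ : Level
    A : Set a

Subsingleton : Pred A ℓ → Set _
Subsingleton P = ∀ {x y} → P x → P y → x ≡ y

subsingleton-∪-pigeonhole : {P Q : Pred A ℓ} → Subsingleton P → Subsingleton Q →
  ∀ {u v w} → (P ∪ Q) u → (P ∪ Q) v → (P ∪ Q) w → u ≢ v → u ≢ w → v ≡ w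
subsingleton-∪-pigeonhole P! Q! _        (inj₁ pv) (inj₁ pw) _   _   = P! pv pw
subsingleton-∪-pigeonhole P! Q! _        (inj₂ qv) (inj₂ qw) _   _   = Q! qv qw
subsingleton-∪-pigeonhole P! Q! (inj₁ pu) (inj₁ pv) (inj₂ _) u≢v _   = ⊥-elim (u≢v (P! pu pv))
subsingleton-∪-pigeonhole P! Q! (inj₂ qu) (inj₁ _)  (inj₂ qw) _  u≢w = ⊥-elim (u≢w (Q! qu qw))
subsingleton-∪-pigeonhole P! Q! (inj₁ pu) (inj₂ _)  (inj₁ pw) _  u≢w = ⊥-elim (u≢w (P! pu pw))
subsingleton-∪-pigeonhole P! Q! (inj₂ qu) (inj₂ qv) (inj₁ _) u≢v _   = ⊥-elim (u≢v (Q! qu qv))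

two-distinct : (m : ℕ) → 2 ≤ m → Σ (Fin m) λ a₀ → Σ (Fin m) λ a₁ → a₀ ≢ a₁
two-distinct (suc (suc m)) _         = fzero , fsuc fzero , λ ()
two-distinct (suc 0)       (s≤s ())

module Merge {A : Set a} (_≟ᴬ_ : DecidableEquality A) (c₁ c₂ : A) where

  InPair : Pred A a
  InPair x = x ≡ c₁ ⊎ x ≡ c₂

  merge : A → A
  merge x with x ≟ᴬ c₁
  ... | yes _ = c₂
  ... | no  _ = x

  merge-fibre : ∀ x y → merge x ≡ merge y → x ≡ y ⊎ (InPair x × InPair y)
  merge-fibre x y e with x ≟ᴬ c₁ | y ≟ᴬ c₁
  ... | yes x≡c₁ | yes y≡c₁ = inj₂ (inj₁ x≡c₁ , inj₁ y≡c₁)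
  ... | yes x≡c₁ | no  _    = inj₂ (inj₁ x≡c₁ , inj₂ (sym e))
  ... | no  _    | yes y≡c₁ = inj₂ (inj₂ e , inj₁ y≡c₁)
  ... | no  _    | no  _    = inj₁ e

  merge-preimage-c₁ : ∀ x → merge x ≡ c₁ → x ≡ c₁ × c₂ ≡ c₁
  merge-preimage-c₁ x e with x ≟ᴬ c₁
  ... | yes x≡c₁ = x≡c₁ , e
  ... | no  x≢c₁ = ⊥-elim (x≢c₁ e)

module _ {s : ℕ} {n : Fin s → ℕ} {k : ℕ} {g : Vertex n → Fin k} (g-relaxed : Is1Relaxed n k g) where

  Adj-irrefl : ∀ {u v} → Adj {n = n} u v → u ≢ v
  Adj-irrefl u≁v refl = u≁v refl

  OutsideWithColour : Fin s → Fin k → Pred (Vertex n) _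
  OutsideWithColour j c v = proj₁ v ≢ j × g v ≡ c

  part-colour-unique-outside : ∀ j b → Subsingleton (OutsideWithColour j (g (j , b)))
  part-colour-unique-outside j b (x∉ , ex) (y∉ , ey) =
    g-relaxed (j , b) _ _ (≢-sym x∉) (≢-sym y∉) ex ey

  repeated-part-colour-absent-outside : ∀ {j a₀ a₁} → a₀ ≢ a₁ → g (j , a₀) ≡ g (j , a₁) →
    ∀ v → ¬ OutsideWithColour j (g (j , a₀)) v
  repeated-part-colour-absent-outside a₀≢a₁ c₁≡c₂ v (v∉ , gv≡c₁) =
    a₀≢a₁ (position-injective (g-relaxed v _ _ v∉ v∉ (sym gv≡c₁) (trans (sym c₁≡c₂) (sym gv≡c₁))))
    where
    position-injective : ∀ {j} {b b′ : Fin (n j)} → _≡_ {A = Vertex n} (j , b) (j , b′) → b ≡ b′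
    position-injective refl = refl

  module Recolouring (j : Fin s) {a₀ a₁ : Fin (n j)} (a₀≢a₁ : a₀ ≢ a₁) where

    c₁ c₂ : Fin k
    c₁ = g (j , a₀)
    c₂ = g (j , a₁)

    open Merge _≟_ c₁ c₂

    recolour : Vertex n → Fin k
    recolour v with proj₁ v ≟ j
    ... | yes _ = c₁
    ... | no  _ = merge (g v)

    recolour-inside : ∀ v → proj₁ v ≡ j → recolour v ≡ c₁
    recolour-inside v v∈ with proj₁ v ≟ j
    ... | yes _  = refl
    ... | no  v∉ = ⊥-elim (v∉ v∈)

    recolour-outside : ∀ v → proj₁ v ≢ j → recolour v ≡ merge (g v)
    recolour-outside v v∉ with proj₁ v ≟ j
    ... | yes v∈ = ⊥-elim (v∉ v∈)
    ... | no  _  = refl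

    recolour≡c₁⇒inside : ∀ v → recolour v ≡ c₁ → proj₁ v ≡ j
    recolour≡c₁⇒inside v e with proj₁ v ≟ j
    ... | yes v∈ = v∈
    ... | no  v∉ with merge-preimage-c₁ (g v) e
    ...   | gv≡c₁ , c₂≡c₁ =
      ⊥-elim (repeated-part-colour-absent-outside a₀≢a₁ (sym c₂≡c₁) v (v∉ , gv≡c₁))

    pair-class-relaxed-outside : ∀ {u v w} → proj₁ u ≢ j → proj₁ v ≢ j → proj₁ w ≢ j →
      InPair (g u) → InPair (g v) → InPair (g w) → Adj {n = n} u v → Adj {n = n} u w → v ≡ w
    pair-class-relaxed-outside u∉ v∉ w∉ pu pv pw u≁v u≁w =
      subsingleton-∪-pigeonhole (part-colour-unique-outside j a₀) (part-colour-unique-outside j a₁)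
        (outside u∉ pu) (outside v∉ pv) (outside w∉ pw) (Adj-irrefl u≁v) (Adj-irrefl u≁w)
      where
      outside : ∀ {x} → proj₁ x ≢ j → InPair (g x) →
        (OutsideWithColour j c₁ ∪ OutsideWithColour j c₂) x
      outside x∉ = Sum.map (x∉ ,_) (x∉ ,_)

    merge-relaxed-outside : ∀ u v w → proj₁ u ≢ j → proj₁ v ≢ j → proj₁ w ≢ j →
      Adj {n = n} u v → Adj {n = n} u w →
      merge (g v) ≡ merge (g u) → merge (g w) ≡ merge (g u) → v ≡ w
    merge-relaxed-outside u v w u∉ v∉ w∉ u≁v u≁w ev ew
      with merge-fibre (g v) (g u) ev | merge-fibre (g w) (g u) ew
    ... | inj₁ gv≡gu     | inj₁ gw≡gu     = g-relaxed u v w u≁v u≁w gv≡gu gw≡gu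
    ... | inj₁ gv≡gu     | inj₂ (pw , pu) =
      pair-class-relaxed-outside u∉ v∉ w∉ pu (subst InPair (sym gv≡gu) pu) pw u≁v u≁w
    ... | inj₂ (pv , pu) | inj₁ gw≡gu     =
      pair-class-relaxed-outside u∉ v∉ w∉ pu pv (subst InPair (sym gw≡gu) pu) u≁v u≁w
    ... | inj₂ (pv , pu) | inj₂ (pw , _)  =
      pair-class-relaxed-outside u∉ v∉ w∉ pu pv pw u≁v u≁w

    same-as-inside : ∀ x {y} → recolour x ≡ recolour y → proj₁ y ≡ j → proj₁ x ≡ j
    same-as-inside x {y} e y∈ = recolour≡c₁⇒inside x (trans e (recolour-inside y y∈))

    recolour-relaxed : Is1Relaxed n k recolour
    recolour-relaxed u v w u≁v u≁w ev ew = by-part (proj₁ u ≟ j)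
      where
      by-part : Dec (proj₁ u ≡ j) → v ≡ w
      by-part (yes u∈) = ⊥-elim (u≁v (trans u∈ (sym (same-as-inside v ev u∈))))
      by-part (no  u∉) =
        merge-relaxed-outside u v w u∉ v∉ w∉ u≁v u≁w
          (trans (sym (recolour-outside v v∉)) (trans ev (recolour-outside u u∉)))
          (trans (sym (recolour-outside w w∉)) (trans ew (recolour-outside u u∉)))
        where
        v∉ : proj₁ v ≢ j
        v∉ v∈ = u∉ (same-as-inside u (sym ev) v∈)
        w∉ : proj₁ w ≢ j
        w∉ w∈ = u∉ (same-as-inside u (sym ew) w∈)

    recolour-constant-on-part : ∀ b b′ → recolour (j , b) ≡ recolour (j , b′)
    recolour-constant-on-part b b′ =
      trans (recolour-inside (j , b) refl) (sym (recolour-inside (j , b′) refl))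

  constant-on-part : ∀ j → 2 ≤ n j →
    Σ (Vertex n → Fin k) λ f → Is1Relaxed n k f × (∀ b b′ → f (j , b) ≡ f (j , b′))
  constant-on-part j 2≤nj with two-distinct (n j) 2≤nj
  ... | _ , _ , a₀≢a₁ = recolour , recolour-relaxed , recolour-constant-on-part
    where open Recolouring j a₀≢a₁

lemma4p1 : (s : ℕ) → 2 ≤ s → (n : Fin s → ℕ) → (j : Fin s) → 2 ≤ n j →
    (k : ℕ) → IsChi1 n k →
    Σ (Vertex n → Fin k) (λ f → Is1Relaxed n k f ×
      (∀ (a b : Fin (n j)) → f (j , a) ≡ f (j , b)))
lemma4p1 s _ n j 2≤nj k ((g , g-relaxed) , _) = constant-on-part g-relaxed j 2≤nj
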